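{- Let $C_n$ denote the cycle on $n\ge 3$ vertices. For $n=3$ and for every $n\geq 5$, $\mathrm{MEG}(C_n)=3$. Moreover, $\mathrm{MEG}(C_4)=4$.
   Context: Two vertices $x,y$ of a graph $G$ monitor an edge $e$ if $e$ belongs to all shortest paths between $x$ and $y$. A set $S\subseteq V(G)$ is a monitoring edge-geodetic set (MEG-set) if for every edge $e$ of $G$ there is a pair $x,y\in S$ that monitors $e$. $\mathrm{MEG}(G)$ denotes the minimum size of an MEG-set of $G$. -}

module Defs where

open import Data.Nat using (ℕ; zero; suc; _≤_)
open import Data.Fin using (Fin; toℕ)
open import Data.Fin.Subset using (Subset; _∈_; ∣_∣)
open import Data.Product using (_×_; Σ; ∃; ∃-syntax)
open import Data.Sum using (_⊎_)
open import Relation.Binary.PropositionalEquality using (_≡_)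
open import Relation.Nullary using (¬_)
open import Data.Empty using (⊥)
open import Data.Sum using (inj₁; inj₂)
open import Data.Product using (_,_)
open import Data.Nat using (s≤s)
open import Data.Nat.Properties using (1+n≢n)
open import Relation.Binary.PropositionalEquality using (refl) renaming (sym to ≡sym)

record Graph (n : ℕ) : Set₁ where
  field
    Adj    : Fin n → Fin n → Set
    sym    : ∀ {u v} → Adj u v → Adj v u
    irrefl : ∀ {u} → ¬ Adj u u
open Graph public

data Walk {n : ℕ} (G : Graph n) : Fin n → Fin n → Set where
  []  : ∀ {x} → Walk G x x
  _∷_ : ∀ {x y z} → Adj G x y → Walk G y z → Walk G x z

length : ∀ {n} {G : Graph n} {x y} → Walk G x y → ℕ
length []      = zero
length (_ ∷ w) = suc (length w)

-- A shortest path between x and y: a walk of minimum length.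
-- (Any such walk is automatically a path.)
IsShortest : ∀ {n} {G : Graph n} {x y} → Walk G x y → Set
IsShortest {G = G} {x} {y} w = ∀ (w' : Walk G x y) → length w ≤ length w'

UsesEdge : ∀ {n} {G : Graph n} → Fin n → Fin n → ∀ {x y} → Walk G x y → Set
UsesEdge u v [] = ⊥
UsesEdge u v (_∷_ {x} {y} _ w) = ((x ≡ u × y ≡ v) ⊎ (x ≡ v × y ≡ u)) ⊎ UsesEdge u v w

Monitors : ∀ {n} (G : Graph n) → Fin n → Fin n → Fin n → Fin n → Set
Monitors G x y u v = ∀ (w : Walk G x y) → IsShortest w → UsesEdge u v w

IsMEGSet : ∀ {n} (G : Graph n) → Subset n → Set
IsMEGSet {n} G S =
  ∀ (u v : Fin n) → Adj G u v → ∃[ x ] ∃[ y ] (x ∈ S × y ∈ S × Monitors G x y u v)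

MEG≡ : ∀ {n} (G : Graph n) → ℕ → Set
MEG≡ {n} G k =
  (∃[ S ] (IsMEGSet G S × ∣ S ∣ ≡ k)) × (∀ (S : Subset n) → IsMEGSet G S → k ≤ ∣ S ∣)

-- The cycle C_n on vertices 0,…,n-1 (i adjacent to i+1 mod n); a simple cycle for n ≥ 3.
CycleAdj : (n : ℕ) → Fin n → Fin n → Set
CycleAdj n i j =
  ((toℕ j ≡ suc (toℕ i)) ⊎ (toℕ i ≡ suc (toℕ j)))
  ⊎ ((toℕ i ≡ 0 × suc (toℕ j) ≡ n) ⊎ (toℕ j ≡ 0 × suc (toℕ i) ≡ n))

private
  cycle-sym : ∀ {n} {i j : Fin n} → CycleAdj n i j → CycleAdj n j i
  cycle-sym (inj₁ (inj₁ p)) = inj₁ (inj₂ p)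
  cycle-sym (inj₁ (inj₂ p)) = inj₁ (inj₁ p)
  cycle-sym (inj₂ (inj₁ p)) = inj₂ (inj₂ p)
  cycle-sym (inj₂ (inj₂ p)) = inj₂ (inj₁ p)

  cycle-irrefl : ∀ {n} → 3 ≤ n → {i : Fin n} → ¬ CycleAdj n i i
  cycle-irrefl _ (inj₁ (inj₁ p)) = 1+n≢n (≡sym p)
  cycle-irrefl _ (inj₁ (inj₂ p)) = 1+n≢n (≡sym p)
  cycle-irrefl h (inj₂ (inj₁ (p , q))) = bad h p q
    where
    bad : ∀ {n} {a : ℕ} → 3 ≤ n → a ≡ 0 → suc a ≡ n → ⊥
    bad (s≤s (s≤s (s≤s _))) refl ()
  cycle-irrefl h (inj₂ (inj₂ (p , q))) = bad h p q
    where
    bad : ∀ {n} {a : ℕ} → 3 ≤ n → a ≡ 0 → suc a ≡ n → ⊥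
    bad (s≤s (s≤s (s≤s _))) refl ()

Cycle : (n : ℕ) → 3 ≤ n → Graph n
Cycle n h = record { Adj = CycleAdj n ; sym = cycle-sym ; irrefl = cycle-irrefl h }

-- Around C_n the distance between labels differing by t is min(t, n ∸ t).  Cut the cycle open
-- at an edge {k, k+1} by lifting the labels 0, …, k by n: the lifted label changes by at most
-- one along every other edge, so a walk from x to y avoiding {k, k+1} is at least as long as
-- the drop of the lifted label from x to y.  Consequently an arc shorter than n/2 is the only
-- geodesic between its ends, and they monitor all its edges; for n = 3 and n ≥ 5 the cycle
-- splits into three such arcs, whose end points form an MEG-set of size 3.  Conversely, for any
-- two vertices one of the two arcs between them is a geodesic, and an edge off that arc is
-- monitored by neither of them, so two vertices never suffice.  In C₄ any two vertices other
-- than v are joined by a geodesic avoiding the edge {v, v+1}, so every vertex lies in every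
-- MEG-set.
module Submission where

open import Defs
open import Data.Nat using (ℕ; zero; suc; _+_; _∸_; _≤_; _<_; s≤s; z≤n; _⊓_; ∣_-_∣)
open import Data.Nat.Properties
open import Data.Fin using (Fin; toℕ; fromℕ<) renaming (zero to fzero)
open import Data.Fin.Properties using (toℕ-injective; toℕ-fromℕ<; toℕ<n) renaming (_≟_ to _≟ᶠ_)
open import Data.Fin.Subset as Subset using (Subset; _∈_; ∣_∣; ⁅_⁆; _∪_; ⊤; inside; outside)
open import Data.Fin.Subset.Properties
  using (x∈⁅x⁆; x∈p∪q⁺; x∈p⇒∣p-x∣<∣p∣; x∈p∧x≢y⇒x∈p-y; ∣⁅x⁆∣≡1; p⊆q⇒∣p∣≤∣q∣; ∣⊤∣≡n; ∈⊤)
open import Data.Vec using ([]; _∷_)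
open import Data.Product using (_×_; ∃-syntax; _,_; proj₁; proj₂)
open import Data.Sum using (_⊎_; inj₁; inj₂; [_,_])
open import Data.Empty using (⊥-elim)
open import Data.Unit using (tt) renaming (⊤ to Unit)
open import Function using (_∘_)
open import Relation.Nullary using (¬_; Dec; yes; no; contradiction)
open import Relation.Nullary.Decidable using (_×-dec_; _⊎-dec_)
open import Relation.Binary.Definitions using (tri<; tri≈; tri>)
open import Relation.Binary.PropositionalEquality using (_≡_; _≢_; refl; cong)
import Relation.Binary.PropositionalEquality as ≡

private
  variable
    d e : ℕ

module _ {n : ℕ} where
  private
    variable
      G : Graph n
      a b c u v x y z : Fin n

  SameEdge : Fin n → Fin n → Fin n → Fin n → Set
  SameEdge u v a b = (a ≡ u × b ≡ v) ⊎ (a ≡ v × b ≡ u)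

  sameEdge? : (u v a b : Fin n) → Dec (SameEdge u v a b)
  sameEdge? u v a b = (a ≟ᶠ u ×-dec b ≟ᶠ v) ⊎-dec (a ≟ᶠ v ×-dec b ≟ᶠ u)

  sameEdge-flip : SameEdge u v a b → SameEdge v u a b
  sameEdge-flip (inj₁ p) = inj₂ p
  sameEdge-flip (inj₂ p) = inj₁ p

  sameEdge-reverse : SameEdge u v a b → SameEdge u v b a
  sameEdge-reverse (inj₁ (p , q)) = inj₂ (q , p)
  sameEdge-reverse (inj₂ (p , q)) = inj₁ (q , p)

  reverseOnto : Walk G a b → Walk G a c → Walk G b c
  reverseOnto         []      acc = acc
  reverseOnto {G = G} (e ∷ w) acc = reverseOnto w (sym G e ∷ acc)

  reverse : Walk G x y → Walk G y x
  reverse w = reverseOnto w []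

  length-reverseOnto : (w : Walk G a b) (acc : Walk G a c) →
                       length (reverseOnto w acc) ≡ length w + length acc
  length-reverseOnto []      acc = refl
  length-reverseOnto (e ∷ w) acc = ≡.trans (length-reverseOnto w _) (+-suc (length w) (length acc))

  length-reverse : (w : Walk G x y) → length (reverse w) ≡ length w
  length-reverse w = ≡.trans (length-reverseOnto w []) (+-identityʳ (length w))

  usesEdge-reverseOnto : (w : Walk G a b) (acc : Walk G a c) →
                         UsesEdge u v (reverseOnto w acc) → UsesEdge u v w ⊎ UsesEdge u v acc
  usesEdge-reverseOnto []      acc p = inj₂ p
  usesEdge-reverseOnto (e ∷ w) acc p with usesEdge-reverseOnto w _ p
  ... | inj₁ q         = inj₁ (inj₂ q)
  ... | inj₂ (inj₁ q)  = inj₁ (inj₁ (sameEdge-reverse q))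
  ... | inj₂ (inj₂ q)  = inj₂ q

  usesEdge-reverse : (w : Walk G x y) → UsesEdge u v (reverse w) → UsesEdge u v w
  usesEdge-reverse w p with usesEdge-reverseOnto w [] p
  ... | inj₁ q = q

  isShortest-reverse : (w : Walk G x y) → IsShortest w → IsShortest (reverse w)
  isShortest-reverse w sh w′ = begin
    length (reverse w)  ≡⟨ length-reverse w ⟩
    length w            ≤⟨ sh (reverse w′) ⟩
    length (reverse w′) ≡⟨ length-reverse w′ ⟩
    length w′           ∎
    where open ≤-Reasoning

  AllSteps : (Fin n → Fin n → Set) → Walk G x y → Set
  AllSteps P []                        = Unit
  AllSteps P (_∷_ {x = a} {y = b} _ w) = P a b × AllSteps P w

  AllSteps-map : {P Q : Fin n → Fin n → Set} → (∀ {a b} → P a b → Q a b) →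
                 (w : Walk G x y) → AllSteps P w → AllSteps Q w
  AllSteps-map f []      _        = tt
  AllSteps-map f (_ ∷ w) (p , ps) = f p , AllSteps-map f w ps

  usesEdge-AllSteps : {P : Fin n → Fin n → Set} (w : Walk G x y) →
                      AllSteps P w → UsesEdge u v w → P u v ⊎ P v u
  usesEdge-AllSteps (_ ∷ w) (p , _)  (inj₁ (inj₁ (refl , refl))) = inj₁ p
  usesEdge-AllSteps (_ ∷ w) (p , _)  (inj₁ (inj₂ (refl , refl))) = inj₂ p
  usesEdge-AllSteps (_ ∷ w) (_ , ps) (inj₂ q)                    = usesEdge-AllSteps w ps q

  usesEdge-flip : (w : Walk G x y) → UsesEdge u v w → UsesEdge v u w
  usesEdge-flip (_ ∷ w) (inj₁ p) = inj₁ (sameEdge-flip p)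
  usesEdge-flip (_ ∷ w) (inj₂ p) = inj₂ (usesEdge-flip w p)

  monitors-flip : Monitors G x y u v → Monitors G x y v u
  monitors-flip mon w sh = usesEdge-flip w (mon w sh)

  monitors-sym : Monitors G x y u v → Monitors G y x u v
  monitors-sym mon w sh = usesEdge-reverse w (mon (reverse w) (isShortest-reverse w sh))

  ¬monitors-refl : ¬ Monitors G x x u v
  ¬monitors-refl mon = mon [] (λ _ → z≤n)

  adjacent-monitors : Adj G u v → Monitors G u v u v
  adjacent-monitors {G = G} adj []           sh = ⊥-elim (irrefl G adj)
  adjacent-monitors         adj (_ ∷ [])     sh = inj₁ (inj₁ (refl , refl))
  adjacent-monitors         adj (_ ∷ _ ∷ _)  sh with sh (adj ∷ [])
  ... | s≤s ()

  ⊤-isMEGSet : IsMEGSet G ⊤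
  ⊤-isMEGSet u v adj = u , v , ∈⊤ , ∈⊤ , adjacent-monitors adj

  Lipschitz : (G : Graph n) → (Fin n → ℕ) → Set
  Lipschitz G g = ∀ {a b} → Adj G a b → g a ≤ suc (g b)

  LipschitzOff : (G : Graph n) → (Fin n → ℕ) → Fin n → Fin n → Set
  LipschitzOff G g u v = ∀ {a b} → Adj G a b → ¬ SameEdge u v a b → g a ≤ suc (g b)

  lipschitz⇒≤length+ : {g : Fin n → ℕ} → Lipschitz G g → (w : Walk G x y) → g x ≤ length w + g y
  lipschitz⇒≤length+ lip []      = ≤-refl
  lipschitz⇒≤length+ lip (e ∷ w) = ≤-trans (lip e) (s≤s (lipschitz⇒≤length+ lip w))

  usesEdge⊎≤length+ : {g : Fin n → ℕ} → LipschitzOff G g u v →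
                      (w : Walk G x y) → UsesEdge u v w ⊎ g x ≤ length w + g y
  usesEdge⊎≤length+         lip []                              = inj₂ ≤-refl
  usesEdge⊎≤length+ {u = u} {v} lip (_∷_ {x = a} {y = b} e w) with sameEdge? u v a b
  ... | yes p = inj₁ (inj₁ p)
  ... | no ¬p with usesEdge⊎≤length+ lip w
  ...   | inj₁ uses  = inj₁ (inj₂ uses)
  ...   | inj₂ bound = inj₂ (≤-trans (lip e ¬p) (s≤s bound))

  lipschitzOff⇒monitors : {g : Fin n → ℕ} → LipschitzOff G g u v →
                          (w₀ : Walk G x y) → length w₀ + g y < g x → Monitors G x y u v
  lipschitzOff⇒monitors {g = g} lip w₀ gap w sh with usesEdge⊎≤length+ lip w
  ... | inj₁ uses  = uses
  ... | inj₂ bound = ⊥-elim (<⇒≱ gap (≤-trans bound (+-monoˡ-≤ (g _) (sh w₀))))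

∣p∪q∣≤∣p∣+∣q∣ : ∀ {n} (p q : Subset n) → ∣ p ∪ q ∣ ≤ ∣ p ∣ + ∣ q ∣
∣p∪q∣≤∣p∣+∣q∣ []            []            = z≤n
∣p∪q∣≤∣p∣+∣q∣ (inside  ∷ p) (inside  ∷ q) = s≤s (≤-trans (∣p∪q∣≤∣p∣+∣q∣ p q) (+-monoʳ-≤ ∣ p ∣ (n≤1+n ∣ q ∣)))
∣p∪q∣≤∣p∣+∣q∣ (inside  ∷ p) (outside ∷ q) = s≤s (∣p∪q∣≤∣p∣+∣q∣ p q)
∣p∪q∣≤∣p∣+∣q∣ (outside ∷ p) (inside  ∷ q) = ≤-trans (s≤s (∣p∪q∣≤∣p∣+∣q∣ p q)) (≤-reflexive (≡.sym (+-suc ∣ p ∣ ∣ q ∣)))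
∣p∪q∣≤∣p∣+∣q∣ (outside ∷ p) (outside ∷ q) = ∣p∪q∣≤∣p∣+∣q∣ p q

module _ {n : ℕ} where
  private
    variable
      G : Graph n
      a u v x y z : Fin n

  ∣⁅x⁆∪⁅y⁆∪⁅z⁆∣≤3 : (x y z : Fin n) → ∣ ⁅ x ⁆ ∪ ⁅ y ⁆ ∪ ⁅ z ⁆ ∣ ≤ 3
  ∣⁅x⁆∪⁅y⁆∪⁅z⁆∣≤3 x y z = begin
    ∣ ⁅ x ⁆ ∪ ⁅ y ⁆ ∪ ⁅ z ⁆ ∣             ≤⟨ ∣p∪q∣≤∣p∣+∣q∣ ⁅ x ⁆ _ ⟩
    ∣ ⁅ x ⁆ ∣ + ∣ ⁅ y ⁆ ∪ ⁅ z ⁆ ∣         ≤⟨ +-monoʳ-≤ ∣ ⁅ x ⁆ ∣ (∣p∪q∣≤∣p∣+∣q∣ ⁅ y ⁆ ⁅ z ⁆) ⟩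
    ∣ ⁅ x ⁆ ∣ + (∣ ⁅ y ⁆ ∣ + ∣ ⁅ z ⁆ ∣)   ≡⟨ ≡.cong₂ _+_ (∣⁅x⁆∣≡1 x) (≡.cong₂ _+_ (∣⁅x⁆∣≡1 y) (∣⁅x⁆∣≡1 z)) ⟩
    3                                     ∎
    where open ≤-Reasoning

  3≤∣p∣ : {p : Subset n} → x ∈ p → y ∈ p → z ∈ p → x ≢ y → x ≢ z → y ≢ z → 3 ≤ ∣ p ∣
  3≤∣p∣ {x = x} {y = y} {z = z} {p = p} x∈p y∈p z∈p x≢y x≢z y≢z = ≤-trans (s≤s two) (x∈p⇒∣p-x∣<∣p∣ x∈p)
    where
    p₁ = p Subset.- x
    p₂ = p₁ Subset.- y
    y∈p₁ : y ∈ p₁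
    y∈p₁ = x∈p∧x≢y⇒x∈p-y y∈p (x≢y ∘ ≡.sym)
    z∈p₂ : z ∈ p₂
    z∈p₂ = x∈p∧x≢y⇒x∈p-y (x∈p∧x≢y⇒x∈p-y z∈p (x≢z ∘ ≡.sym)) (y≢z ∘ ≡.sym)
    one : 1 ≤ ∣ p₂ ∣
    one = ≤-trans (s≤s z≤n) (x∈p⇒∣p-x∣<∣p∣ z∈p₂)
    two : 2 ≤ ∣ p₁ ∣
    two = ≤-trans (s≤s one) (x∈p⇒∣p-x∣<∣p∣ y∈p₁)

  MissesAnEdge : Graph n → Fin n → Fin n → Set
  MissesAnEdge G x y = ∃[ u ] ∃[ v ] (Adj G u v × ¬ Monitors G x y u v × ¬ Monitors G y x u v)

  3≤∣MEGSet∣ : {S : Subset n} → Adj G u v → (∀ {x y} → x ≢ y → MissesAnEdge G x y) →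
               IsMEGSet G S → 3 ≤ ∣ S ∣
  3≤∣MEGSet∣ {S = S} adj misses meg with meg _ _ adj
  ... | x , y , x∈S , y∈S , mon =
    let z , z∈S , x≢z , y≢z = third in 3≤∣p∣ x∈S y∈S z∈S x≢y x≢z y≢z
    where
    x≢y : x ≢ y
    x≢y refl = ¬monitors-refl mon
    inPair? : ∀ z → z ≡ x ⊎ z ≡ y ⊎ (x ≢ z × y ≢ z)
    inPair? z with z ≟ᶠ x | z ≟ᶠ y
    ... | yes z≡x | _       = inj₁ z≡x
    ... | no _    | yes z≡y = inj₂ (inj₁ z≡y)
    ... | no z≢x  | no z≢y  = inj₂ (inj₂ (z≢x ∘ ≡.sym , z≢y ∘ ≡.sym))
    third : ∃[ z ] (z ∈ S × x ≢ z × y ≢ z)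
    third with misses x≢y
    ... | u′ , v′ , adj′ , ¬mon-xy , ¬mon-yx with meg u′ v′ adj′
    ... | x′ , y′ , x′∈S , y′∈S , mon′ with inPair? x′ | inPair? y′
    ...   | inj₂ (inj₂ new)  | _                = x′ , x′∈S , new
    ...   | _                | inj₂ (inj₂ new)  = y′ , y′∈S , new
    ...   | inj₁ refl        | inj₁ refl        = ⊥-elim (¬monitors-refl mon′)
    ...   | inj₁ refl        | inj₂ (inj₁ refl) = ⊥-elim (¬mon-xy mon′)
    ...   | inj₂ (inj₁ refl) | inj₁ refl        = ⊥-elim (¬mon-yx mon′)
    ...   | inj₂ (inj₁ refl) | inj₂ (inj₁ refl) = ⊥-elim (¬monitors-refl mon′)

  ∈MEGSet : {S : Subset n} → Adj G v a → (∀ {x y} → Monitors G x y v a → x ≡ v ⊎ y ≡ v) →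
            IsMEGSet G S → v ∈ S
  ∈MEGSet adj onlyAt-v meg with meg _ _ adj
  ... | x , y , x∈S , y∈S , mon with onlyAt-v mon
  ...   | inj₁ refl = x∈S
  ...   | inj₂ refl = y∈S

  n≤∣MEGSet∣ : {S : Subset n} →
               (∀ v → ∃[ w ] (Adj G v w × ∀ {x y} → Monitors G x y v w → x ≡ v ⊎ y ≡ v)) →
               IsMEGSet G S → n ≤ ∣ S ∣
  n≤∣MEGSet∣ privateEdge meg =
    ≤-trans (≤-reflexive (≡.sym (∣⊤∣≡n n)))
            (p⊆q⇒∣p∣≤∣q∣ {p = ⊤} λ {v} _ → let _ , adj , onlyAt-v = privateEdge v in ∈MEGSet adj onlyAt-v meg)

shorterWay : ℕ → ℕ → ℕ
shorterWay n t = t ⊓ (n ∸ t)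

shorterWay-lipschitz : ∀ n {t t′} → t ≤ suc t′ → t′ ≤ suc t → shorterWay n t ≤ suc (shorterWay n t′)
shorterWay-lipschitz n {t} {t′} t≤1+t′ t′≤1+t = ⊓-mono-≤ t≤1+t′ (m≤n+o⇒m∸n≤o n t n≤t+1+[n∸t′])
  where
  open ≤-Reasoning
  n≤t+1+[n∸t′] : n ≤ t + suc (n ∸ t′)
  n≤t+1+[n∸t′] = begin
    n                 ≤⟨ m≤n+m∸n n t′ ⟩
    t′ + (n ∸ t′)     ≤⟨ +-monoˡ-≤ (n ∸ t′) t′≤1+t ⟩
    suc t + (n ∸ t′)  ≡⟨ ≡.sym (+-suc t (n ∸ t′)) ⟩
    t + suc (n ∸ t′)  ∎

shorterWay-reflect : ∀ {n t} → t ≤ n → shorterWay n (n ∸ t) ≡ shorterWay n t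
shorterWay-reflect {n} {t} t≤n = ≡.trans (cong ((n ∸ t) ⊓_) (m∸[m∸n]≡n t≤n)) (⊓-comm (n ∸ t) t)

∣-∣-adjacent : ∀ {m m′} o → m′ ≡ suc m → ∣ m - o ∣ ≤ suc ∣ m′ - o ∣ × ∣ m′ - o ∣ ≤ suc ∣ m - o ∣
∣-∣-adjacent {m} o refl =
  ≤-trans (∣-∣-triangle m (suc m) o) (≤-reflexive (cong (_+ ∣ suc m - o ∣) ∣m-1+m∣≡1)) ,
  ≤-trans (∣-∣-triangle (suc m) m o) (≤-reflexive (cong (_+ ∣ m - o ∣) (≡.trans (∣-∣-comm (suc m) m) ∣m-1+m∣≡1)))
  where
  ∣m-1+m∣≡1 : ∣ m - suc m ∣ ≡ 1
  ∣m-1+m∣≡1 = ≡.trans (cong (∣ m -_∣) (+-comm 1 m)) (∣m-m+n∣≡n m 1)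

Near : ℕ → ℕ → Set
Near p q = p ≤ suc q × q ≤ suc p

near-suc : ∀ m → Near m (suc m)
near-suc m = m≤n⇒m≤1+n (n≤1+n m) , ≤-refl

2d≤d+e⇒d≤e : ∀ {d e n} → d + e ≡ n → d + d ≤ n → d ≤ e
2d≤d+e⇒d≤e {d} {e} d+e≡n 2d≤n = +-cancelˡ-≤ d d e (≤-trans 2d≤n (≤-reflexive (≡.sym d+e≡n)))

d+e≤2d⇒e≤d : ∀ {d e n} → d + e ≡ n → n ≤ d + d → e ≤ d
d+e≤2d⇒e≤d {d} {e} d+e≡n n≤2d = +-cancelʳ-≤ d e d (≤-trans (≤-reflexive (≡.trans (+-comm e d) d+e≡n)) n≤2d)

data CycleStep {n : ℕ} (a b : Fin n) : Set where
  ascend : toℕ b ≡ suc (toℕ a) → CycleStep a b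
  wrap   : suc (toℕ a) ≡ n → toℕ b ≡ 0 → CycleStep a b

successor : ∀ {n} (a : Fin n) → ∃[ b ] CycleStep a b
successor {suc n} a with suc (toℕ a) <? suc n
... | yes 1+a<1+n = fromℕ< 1+a<1+n , ascend (toℕ-fromℕ< 1+a<1+n)
... | no  1+a≮1+n = fzero , wrap (≤-antisym (toℕ<n a) (≮⇒≥ 1+a≮1+n)) refl

module _ {n : ℕ} where
  private
    variable
      a b c x y : Fin n

  cycleStep⇒adj : CycleStep a b → CycleAdj n a b
  cycleStep⇒adj (ascend b≡1+a)   = inj₁ (inj₁ b≡1+a)
  cycleStep⇒adj (wrap 1+a≡n b≡0) = inj₂ (inj₂ (b≡0 , 1+a≡n))

  adj⇒cycleStep : CycleAdj n a b → CycleStep a b ⊎ CycleStep b a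
  adj⇒cycleStep (inj₁ (inj₁ b≡1+a))          = inj₁ (ascend b≡1+a)
  adj⇒cycleStep (inj₁ (inj₂ a≡1+b))          = inj₂ (ascend a≡1+b)
  adj⇒cycleStep (inj₂ (inj₁ (a≡0 , 1+b≡n)))  = inj₂ (wrap 1+b≡n a≡0)
  adj⇒cycleStep (inj₂ (inj₂ (b≡0 , 1+a≡n)))  = inj₁ (wrap 1+a≡n b≡0)

  cycleStep-functional : CycleStep a b → CycleStep a c → b ≡ c
  cycleStep-functional (ascend b≡1+a) (ascend c≡1+a) = toℕ-injective (≡.trans b≡1+a (≡.sym c≡1+a))
  cycleStep-functional {b = b} (ascend b≡1+a) (wrap 1+a≡n _) =
    ⊥-elim (<-irrefl (≡.trans b≡1+a 1+a≡n) (toℕ<n b))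
  cycleStep-functional {c = c} (wrap 1+a≡n _) (ascend c≡1+a) =
    ⊥-elim (<-irrefl (≡.trans c≡1+a 1+a≡n) (toℕ<n c))
  cycleStep-functional (wrap _ b≡0) (wrap _ c≡0) = toℕ-injective (≡.trans b≡0 (≡.sym c≡0))

  ¬cycleStep-both : 3 ≤ n → CycleStep a b → ¬ CycleStep b a
  ¬cycleStep-both _ (ascend b≡1+a) (ascend a≡1+b) = n≢2+n (≡.trans a≡1+b (cong suc b≡1+a))
    where
    n≢2+n : ∀ {m} → m ≢ suc (suc m)
    n≢2+n ()
  ¬cycleStep-both 3≤n (ascend b≡1+a) (wrap 1+b≡n a≡0) =
    <⇒≢ 3≤n (≡.trans (cong suc (≡.trans (cong suc (≡.sym a≡0)) (≡.sym b≡1+a))) 1+b≡n)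
  ¬cycleStep-both 3≤n (wrap 1+a≡n b≡0) (ascend a≡1+b) =
    <⇒≢ 3≤n (≡.trans (cong suc (≡.trans (cong suc (≡.sym b≡0)) (≡.sym a≡1+b))) 1+a≡n)
  ¬cycleStep-both 3≤n (wrap 1+a≡n b≡0) (wrap _ a≡0) =
    <⇒≢ (≤-trans (n≤1+n 2) 3≤n) (≡.trans (cong suc (≡.sym a≡0)) 1+a≡n)

  cycleDist : Fin n → Fin n → ℕ
  cycleDist a b = shorterWay n ∣ toℕ a - toℕ b ∣

  cycleDist-self : (a : Fin n) → cycleDist a a ≡ 0
  cycleDist-self a = cong (shorterWay n) (∣n-n∣≡0 (toℕ a))

  cycleDist-offset : toℕ y ≡ toℕ x + d → d + e ≡ n → cycleDist x y ≡ d ⊓ e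
  cycleDist-offset {y = y} {x = x} {d = d} {e = e} y≡x+d d+e≡n = begin
    shorterWay n ∣ toℕ x - toℕ y ∣       ≡⟨ cong (λ t → shorterWay n ∣ toℕ x - t ∣) y≡x+d ⟩
    shorterWay n ∣ toℕ x - toℕ x + d ∣   ≡⟨ cong (shorterWay n) (∣m-m+n∣≡n (toℕ x) d) ⟩
    d ⊓ (n ∸ d)                          ≡⟨ cong (d ⊓_) (≡.trans (cong (_∸ d) (≡.sym d+e≡n)) (m+n∸m≡n d e)) ⟩
    d ⊓ e                                ∎
    where open ≡.≡-Reasoning

  cycleDist-last : suc (toℕ a) ≡ n → ∀ c → cycleDist a c ≡ shorterWay n (suc (toℕ c))
  cycleDist-last {a} 1+α≡n c = begin
    shorterWay n ∣ α - γ ∣      ≡⟨ cong (shorterWay n) (m≤n⇒∣n-m∣≡n∸m γ≤α) ⟩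
    shorterWay n (α ∸ γ)        ≡⟨ ≡.sym (shorterWay-reflect α∸γ≤n) ⟩
    shorterWay n (n ∸ (α ∸ γ))  ≡⟨ cong (shorterWay n) n∸[α∸γ]≡1+γ ⟩
    shorterWay n (suc γ)        ∎
    where
    open ≡.≡-Reasoning
    α = toℕ a
    γ = toℕ c
    γ≤α : γ ≤ α
    γ≤α = ≤-pred (≤-trans (toℕ<n c) (≤-reflexive (≡.sym 1+α≡n)))
    α∸γ≤n : α ∸ γ ≤ n
    α∸γ≤n = ≤-trans (m∸n≤m α γ) (≤-trans (n≤1+n α) (≤-reflexive 1+α≡n))
    n∸[α∸γ]≡1+γ : n ∸ (α ∸ γ) ≡ suc γ
    n∸[α∸γ]≡1+γ = begin
      n ∸ (α ∸ γ)         ≡⟨ cong (_∸ (α ∸ γ)) (≡.sym 1+α≡n) ⟩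
      suc α ∸ (α ∸ γ)     ≡⟨ +-∸-assoc 1 (m∸n≤m α γ) ⟩
      suc (α ∸ (α ∸ γ))   ≡⟨ cong suc (m∸[m∸n]≡n γ≤α) ⟩
      suc γ               ∎

  cycleDist-step : CycleStep a b → ∀ c → cycleDist a c ≤ suc (cycleDist b c) × cycleDist b c ≤ suc (cycleDist a c)
  cycleDist-step (ascend b≡1+a) c =
    let a-c≤ , b-c≤ = ∣-∣-adjacent (toℕ c) b≡1+a
    in shorterWay-lipschitz n a-c≤ b-c≤ , shorterWay-lipschitz n b-c≤ a-c≤
  cycleDist-step {a} {b} (wrap 1+a≡n b≡0) c =
    ≡.subst₂ (λ s t → s ≤ suc t) (≡.sym a-c≡) (≡.sym b-c≡) (shorterWay-lipschitz n ≤-refl (m≤n⇒m≤1+n (n≤1+n _))) ,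
    ≡.subst₂ (λ s t → s ≤ suc t) (≡.sym b-c≡) (≡.sym a-c≡) (shorterWay-lipschitz n (m≤n⇒m≤1+n (n≤1+n _)) ≤-refl)
    where
    a-c≡ = cycleDist-last 1+a≡n c
    b-c≡ : cycleDist b c ≡ shorterWay n (toℕ c)
    b-c≡ = cong (λ t → shorterWay n ∣ t - toℕ c ∣) b≡0

  cycleDist-lipschitz : ∀ {h} c → Lipschitz (Cycle n h) (λ a → cycleDist a c)
  cycleDist-lipschitz c adj with adj⇒cycleStep adj
  ... | inj₁ step = proj₁ (cycleDist-step step c)
  ... | inj₂ step = proj₂ (cycleDist-step step c)

  cycleDist≤length : ∀ {h} (w : Walk (Cycle n h) x y) → cycleDist x y ≤ length w
  cycleDist≤length {x = x} {y = y} {h} w = begin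
    cycleDist x y                ≤⟨ lipschitz⇒≤length+ (cycleDist-lipschitz {h = h} y) w ⟩
    length w + cycleDist y y     ≡⟨ cong (length w +_) (cycleDist-self y) ⟩
    length w + 0                 ≡⟨ +-identityʳ (length w) ⟩
    length w                     ∎
    where open ≤-Reasoning

  cycleDist-sym : (a b : Fin n) → cycleDist a b ≡ cycleDist b a
  cycleDist-sym a b = cong (shorterWay n) (∣-∣-comm (toℕ a) (toℕ b))

  arcLengths : toℕ x ≤ toℕ y → ∃[ d ] ∃[ e ] (toℕ y ≡ toℕ x + d × d + e ≡ n)
  arcLengths {x} {y} x≤y =
    toℕ y ∸ toℕ x , n ∸ (toℕ y ∸ toℕ x) ,
    ≡.sym (m+[n∸m]≡n x≤y) , m+[n∸m]≡n (≤-trans (m∸n≤m (toℕ y) (toℕ x)) (<⇒≤ (toℕ<n y)))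

record ArcSplit (n : ℕ) : Set where
  constructor mkArcSplit
  field
    p q s   : ℕ
    p+q+s≡n : p + q + s ≡ n
    p<q+s   : p < q + s
    q<p+s   : q < p + s
    s<p+q   : s < p + q

  0<s : 0 < s
  0<s with s | p<q+s | q<p+s
  ... | suc _ | _     | _     = s≤s z≤n
  ... | zero  | p<q+0 | q<p+0 =
    contradiction (<-trans (≤-trans p<q+0 (≤-reflexive (+-identityʳ q)))
                           (≤-trans q<p+0 (≤-reflexive (+-identityʳ p)))) (<-irrefl refl)

  p+q<n : p + q < n
  p+q<n = ≤-trans (m<m+n (p + q) 0<s) (≤-reflexive p+q+s≡n)

  p<n : p < n
  p<n = ≤-<-trans (m≤m+n p q) p+q<n

  cut₀ cut₁ cut₂ : Fin n
  cut₀ = fromℕ< (≤-<-trans z≤n p<n)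
  cut₁ = fromℕ< p<n
  cut₂ = fromℕ< p+q<n

  cut₀≡0 : toℕ cut₀ ≡ 0
  cut₀≡0 = toℕ-fromℕ< _

  cut₁≡p : toℕ cut₁ ≡ p
  cut₁≡p = toℕ-fromℕ< p<n

  cut₂≡p+q : toℕ cut₂ ≡ p + q
  cut₂≡p+q = toℕ-fromℕ< p+q<n

arcSplit-widen : ∀ {n} → ArcSplit n → ArcSplit (2 + n)
arcSplit-widen (mkArcSplit p q s p+q+s≡n p<q+s q<p+s s<p+q) =
  mkArcSplit (suc p) (suc q) s
    (cong suc (≡.trans (cong (_+ s) (+-suc p q)) (cong suc p+q+s≡n)))
    (s≤s p<q+s) (s≤s q<p+s) (≤-trans s<p+q (+-mono-≤ (n≤1+n p) (n≤1+n q)))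

arcSplit : ∀ {n} → n ≡ 3 ⊎ 5 ≤ n → ArcSplit n
arcSplit (inj₁ refl) = mkArcSplit 1 1 1 refl ≤-refl ≤-refl ≤-refl
arcSplit (inj₂ (s≤s (s≤s (s≤s (s≤s (s≤s {n = k} _)))))) = split5+ k
  where
  split5+ : ∀ k → ArcSplit (5 + k)
  split5+ zero          = mkArcSplit 2 2 1 refl ≤-refl ≤-refl (s≤s (s≤s z≤n))
  split5+ (suc zero)    = mkArcSplit 2 2 2 refl 2<4 2<4 2<4
    where 2<4 = s≤s (s≤s (s≤s z≤n))
  split5+ (suc (suc k)) = arcSplit-widen (split5+ k)

module _ {n : ℕ} (3≤n : 3 ≤ n) where
  private
    C = Cycle n 3≤n
    variable
      R R′ : Fin n → Set
      a b k l x y z : Fin n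

  record Arc (R : Fin n → Set) (x y : Fin n) (d : ℕ) : Set where
    field
      walk    : Walk C x y
      length≡ : length walk ≡ d
      steps   : AllSteps (λ a b → CycleStep a b × R a) walk
  open Arc

  infixr 5 _◅_
  _◅_ : CycleStep a b × R a → Arc R b y d → Arc R a y (suc d)
  (step , r) ◅ A = record
    { walk = cycleStep⇒adj step ∷ walk A ; length≡ = cong suc (length≡ A) ; steps = (step , r) , steps A }

  arc-mono : (∀ {a} → R a → R′ a) → Arc R x y d → Arc R′ x y d
  arc-mono R⊆R′ A = record
    { walk = walk A ; length≡ = length≡ A ; steps = AllSteps-map (λ (s , r) → s , R⊆R′ r) (walk A) (steps A) }

  ascent : toℕ y ≡ toℕ x + d → Arc (λ a → toℕ x ≤ toℕ a × toℕ a < toℕ y) x y d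
  ascent {y} {x} {zero} y≡x+0 with toℕ-injective (≡.trans y≡x+0 (+-identityʳ (toℕ x)))
  ... | refl = record { walk = [] ; length≡ = refl ; steps = tt }
  ascent {y} {x} {suc d} y≡x+1+d =
    (ascend (toℕ-fromℕ< 1+x<n) , ≤-refl , x<y) ◅ arc-mono weaken (ascent y≡1+x+d)
    where
    x<y : toℕ x < toℕ y
    x<y = ≤-trans (s≤s (m≤m+n (toℕ x) d)) (≤-reflexive (≡.sym (≡.trans y≡x+1+d (+-suc (toℕ x) d))))
    1+x<n : suc (toℕ x) < n
    1+x<n = ≤-<-trans x<y (toℕ<n y)
    x′ = fromℕ< 1+x<n
    y≡1+x+d : toℕ y ≡ toℕ x′ + d
    y≡1+x+d = ≡.trans y≡x+1+d (≡.trans (+-suc (toℕ x) d) (cong (_+ d) (≡.sym (toℕ-fromℕ< 1+x<n))))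
    weaken : ∀ {a} → toℕ x′ ≤ toℕ a × toℕ a < toℕ y → toℕ x ≤ toℕ a × toℕ a < toℕ y
    weaken (x′≤a , a<y) = ≤-trans (n≤1+n (toℕ x)) (≤-trans (≤-reflexive (≡.sym (toℕ-fromℕ< 1+x<n))) x′≤a) , a<y

  wrapArc : toℕ x + n ≡ toℕ y + e → Arc (λ a → toℕ y ≤ toℕ a ⊎ toℕ a < toℕ x) y x e
  wrapArc {x} {y} {zero} x+n≡y+0 =
    ⊥-elim (<⇒≱ (toℕ<n y) (≤-trans (m≤n+m n (toℕ x)) (≤-reflexive (≡.trans x+n≡y+0 (+-identityʳ (toℕ y))))))
  wrapArc {x} {y} {suc e} x+n≡y+1+e with successor y
  ... | b , step@(ascend b≡1+y) =
    (step , inj₁ ≤-refl) ◅ arc-mono [ inj₁ ∘ ≤-trans y≤b , inj₂ ] (wrapArc x+n≡b+e)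
    where
    y≤b : toℕ y ≤ toℕ b
    y≤b = ≤-trans (n≤1+n (toℕ y)) (≤-reflexive (≡.sym b≡1+y))
    x+n≡b+e : toℕ x + n ≡ toℕ b + e
    x+n≡b+e = ≡.trans x+n≡y+1+e (≡.trans (+-suc (toℕ y) e) (cong (_+ e) (≡.sym b≡1+y)))
  ... | b , step@(wrap 1+y≡n b≡0) =
    (step , inj₁ ≤-refl) ◅ arc-mono (λ (_ , a<x) → inj₂ a<x) (ascent (≡.trans x≡e (cong (_+ e) (≡.sym b≡0))))
    where
    x≡e : toℕ x ≡ e
    x≡e = +-cancelʳ-≡ n (toℕ x) e (begin
      toℕ x + n         ≡⟨ x+n≡y+1+e ⟩
      toℕ y + suc e     ≡⟨ +-suc (toℕ y) e ⟩
      suc (toℕ y) + e   ≡⟨ cong (_+ e) 1+y≡n ⟩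
      n + e             ≡⟨ +-comm n e ⟩
      e + n             ∎)
      where open ≡.≡-Reasoning

  arc-avoids : (A : Arc R x y d) → CycleStep k l → ¬ R k → ¬ UsesEdge k l (walk A)
  arc-avoids A kl ¬Rk uses with usesEdge-AllSteps (walk A) (steps A) uses
  ... | inj₁ (_ , Rk) = ¬Rk Rk
  ... | inj₂ (lk , _) = ¬cycleStep-both 3≤n kl lk

  arc-isShortest : (A : Arc R x y d) → d ≤ cycleDist x y → IsShortest (walk A)
  arc-isShortest A d≤dist w = ≤-trans (≤-reflexive (length≡ A)) (≤-trans d≤dist (cycleDist≤length {h = 3≤n} w))

  geodesicArc-¬monitors : Arc R x y d → d ≤ cycleDist x y → CycleStep k l → ¬ R k → ¬ Monitors C x y k l
  geodesicArc-¬monitors A d≤dist kl ¬Rk mon = arc-avoids A kl ¬Rk (mon (walk A) (arc-isShortest A d≤dist))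

  unroll : Fin n → Fin n → ℕ
  unroll k a with toℕ a ≤? toℕ k
  ... | yes _ = toℕ a + n
  ... | no  _ = toℕ a

  unroll-≤ : toℕ a ≤ toℕ k → unroll k a ≡ toℕ a + n
  unroll-≤ {a} {k} a≤k with toℕ a ≤? toℕ k
  ... | yes _   = refl
  ... | no  a≰k = contradiction a≤k a≰k

  unroll-> : toℕ k < toℕ a → unroll k a ≡ toℕ a
  unroll-> {k} {a} k<a with toℕ a ≤? toℕ k
  ... | yes a≤k = contradiction a≤k (<⇒≱ k<a)
  ... | no  _   = refl

  unroll-step : CycleStep k l → CycleStep a b → (a ≡ k × b ≡ l) ⊎ Near (unroll k a) (unroll k b)
  unroll-step {k} {l} {a} {b} kl ab with <-cmp (toℕ a) (toℕ k) | ab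
  ... | tri< a<k _ _ | ascend b≡1+a =
    inj₂ (≡.subst₂ Near (≡.sym (unroll-≤ (<⇒≤ a<k))) (≡.sym (≡.trans (unroll-≤ b≤k) (cong (_+ n) b≡1+a)))
                   (near-suc (toℕ a + n)))
    where
    b≤k : toℕ b ≤ toℕ k
    b≤k = ≤-trans (≤-reflexive b≡1+a) a<k
  ... | tri< a<k _ _ | wrap 1+a≡n _ =
    contradiction (≤-pred (≤-trans (toℕ<n k) (≤-reflexive (≡.sym 1+a≡n)))) (<⇒≱ a<k)
  ... | tri> _ _ k<a | ascend b≡1+a =
    inj₂ (≡.subst₂ Near (≡.sym (unroll-> k<a)) (≡.sym (≡.trans (unroll-> k<b) b≡1+a)) (near-suc (toℕ a)))
    where
    k<b : toℕ k < toℕ b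
    k<b = ≤-trans k<a (≤-trans (n≤1+n (toℕ a)) (≤-reflexive (≡.sym b≡1+a)))
  ... | tri> _ _ k<a | wrap 1+a≡n b≡0 =
    inj₂ (≡.subst₂ Near (≡.sym (unroll-> k<a)) (≡.sym (≡.trans (unroll-≤ b≤k) (≡.trans (cong (_+ n) b≡0) (≡.sym 1+a≡n))))
                   (near-suc (toℕ a)))
    where
    b≤k : toℕ b ≤ toℕ k
    b≤k = ≤-trans (≤-reflexive b≡0) z≤n
  ... | tri≈ _ a≡k _ | _ with toℕ-injective a≡k
  ...   | refl = inj₁ (refl , cycleStep-functional ab kl)

  unroll-lipschitzOff : CycleStep k l → LipschitzOff C (unroll k) k l
  unroll-lipschitzOff kl adj ¬same with adj⇒cycleStep adj
  ... | inj₁ ab with unroll-step kl ab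
  ...   | inj₁ (a≡k , b≡l) = contradiction (inj₁ (a≡k , b≡l)) ¬same
  ...   | inj₂ near        = proj₁ near
  unroll-lipschitzOff kl adj ¬same | inj₂ ba with unroll-step kl ba
  ...   | inj₁ (b≡k , a≡l) = contradiction (inj₂ (a≡l , b≡k)) ¬same
  ...   | inj₂ near        = proj₂ near

  ascent-monitors : toℕ y ≡ toℕ x + d → d + e ≡ n → d < e →
                    toℕ x ≤ toℕ k → toℕ k < toℕ y → CycleStep k l → Monitors C x y k l
  ascent-monitors {y} {x} {d} {e} {k} y≡x+d d+e≡n d<e x≤k k<y kl =
    lipschitzOff⇒monitors (unroll-lipschitzOff kl) (walk A) (begin-strict
      length (walk A) + unroll k y  ≡⟨ ≡.cong₂ _+_ (length≡ A) (unroll-> k<y) ⟩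
      d + toℕ y                     ≡⟨ cong (d +_) y≡x+d ⟩
      d + (toℕ x + d)               ≡⟨ +-comm d (toℕ x + d) ⟩
      toℕ x + d + d                 ≡⟨ +-assoc (toℕ x) d d ⟩
      toℕ x + (d + d)               <⟨ +-monoʳ-< (toℕ x) (+-monoʳ-< d d<e) ⟩
      toℕ x + (d + e)               ≡⟨ cong (toℕ x +_) d+e≡n ⟩
      toℕ x + n                     ≡⟨ ≡.sym (unroll-≤ x≤k) ⟩
      unroll k x                    ∎)
    where
    open ≤-Reasoning
    A = ascent y≡x+d

  wrapArc-monitors : toℕ z ≡ 0 → toℕ y + e ≡ n → e < toℕ y →
                     toℕ y ≤ toℕ k → CycleStep k l → Monitors C y z k l
  wrapArc-monitors {z} {y} {e} {k} z≡0 y+e≡n e<y y≤k kl =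
    lipschitzOff⇒monitors (unroll-lipschitzOff kl) (walk A) (begin-strict
      length (walk A) + unroll k z  ≡⟨ ≡.cong₂ _+_ (length≡ A) (unroll-≤ z≤k) ⟩
      e + (toℕ z + n)               ≡⟨ cong (λ t → e + (t + n)) z≡0 ⟩
      e + n                         <⟨ +-monoˡ-< n e<y ⟩
      toℕ y + n                     ≡⟨ ≡.sym (unroll-≤ y≤k) ⟩
      unroll k y                    ∎)
    where
    open ≤-Reasoning
    z≤k : toℕ z ≤ toℕ k
    z≤k = ≤-trans (≤-reflexive z≡0) z≤n
    A = wrapArc (≡.trans (cong (_+ n) z≡0) (≡.sym y+e≡n))

  ascent-¬monitors : toℕ y ≡ toℕ x + d → d + e ≡ n → d ≤ e → CycleStep k l →
                     ¬ (toℕ x ≤ toℕ k × toℕ k < toℕ y) → ¬ Monitors C x y k l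
  ascent-¬monitors y≡x+d d+e≡n d≤e =
    geodesicArc-¬monitors (ascent y≡x+d)
      (≤-trans (⊓-glb ≤-refl d≤e) (≤-reflexive (≡.sym (cycleDist-offset y≡x+d d+e≡n))))

  wrapArc-¬monitors : toℕ y ≡ toℕ x + d → d + e ≡ n → e ≤ d → CycleStep k l →
                      ¬ (toℕ y ≤ toℕ k ⊎ toℕ k < toℕ x) → ¬ Monitors C y x k l
  wrapArc-¬monitors {y} {x} {d} {e} y≡x+d d+e≡n e≤d =
    geodesicArc-¬monitors (wrapArc x+n≡y+e)
      (≤-trans (⊓-glb e≤d ≤-refl)
               (≤-reflexive (≡.sym (≡.trans (cycleDist-sym y x) (cycleDist-offset y≡x+d d+e≡n)))))
    where
    open ≡.≡-Reasoning
    x+n≡y+e : toℕ x + n ≡ toℕ y + e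
    x+n≡y+e = begin
      toℕ x + n        ≡⟨ cong (toℕ x +_) (≡.sym d+e≡n) ⟩
      toℕ x + (d + e)  ≡⟨ ≡.sym (+-assoc (toℕ x) d e) ⟩
      toℕ x + d + e    ≡⟨ cong (_+ e) (≡.sym y≡x+d) ⟩
      toℕ y + e        ∎

  ordered-missesAnEdge : toℕ x < toℕ y → MissesAnEdge C x y
  ordered-missesAnEdge {x} {y} x<y with arcLengths (<⇒≤ x<y)
  ... | d , e , y≡x+d , d+e≡n with ≤-total d e
  ...   | inj₁ d≤e =
    let l , yl = successor y
        ¬mon   = ascent-¬monitors y≡x+d d+e≡n d≤e yl (λ (_ , y<y) → <-irrefl refl y<y)
    in y , l , cycleStep⇒adj yl , ¬mon , ¬mon ∘ monitors-sym
  ...   | inj₂ e≤d =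
    let l , xl = successor x
        ¬mon   = wrapArc-¬monitors y≡x+d d+e≡n e≤d xl [ <⇒≱ x<y , <-irrefl refl ]
    in x , l , cycleStep⇒adj xl , ¬mon ∘ monitors-sym , ¬mon

  missesAnEdge : x ≢ y → MissesAnEdge C x y
  missesAnEdge {x} {y} x≢y with <-cmp (toℕ x) (toℕ y)
  ... | tri< x<y _ _ = ordered-missesAnEdge x<y
  ... | tri≈ _ x≡y _ = contradiction (toℕ-injective x≡y) x≢y
  ... | tri> _ _ y<x = let u , v , adj , ¬yx , ¬xy = ordered-missesAnEdge y<x in u , v , adj , ¬xy , ¬yx

  arcSplit-MEGSet : ArcSplit n → ∃[ S ] (IsMEGSet C S × ∣ S ∣ ≤ 3)
  arcSplit-MEGSet split = S , isMEG , ∣⁅x⁆∪⁅y⁆∪⁅z⁆∣≤3 cut₀ cut₁ cut₂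
    where
    open ArcSplit split
    S = ⁅ cut₀ ⁆ ∪ ⁅ cut₁ ⁆ ∪ ⁅ cut₂ ⁆
    cut₀∈S : cut₀ ∈ S
    cut₀∈S = x∈p∪q⁺ (inj₁ (x∈⁅x⁆ cut₀))
    cut₁∈S : cut₁ ∈ S
    cut₁∈S = x∈p∪q⁺ (inj₂ (x∈p∪q⁺ (inj₁ (x∈⁅x⁆ cut₁))))
    cut₂∈S : cut₂ ∈ S
    cut₂∈S = x∈p∪q⁺ {p = ⁅ cut₀ ⁆} (inj₂ (x∈p∪q⁺ (inj₂ (x∈⁅x⁆ cut₂))))

    monitored : CycleStep k l → ∃[ x ] ∃[ y ] (x ∈ S × y ∈ S × Monitors C x y k l)
    monitored {k} kl with toℕ k <? p | toℕ k <? p + q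
    ... | yes k<p | _ =
      cut₀ , cut₁ , cut₀∈S , cut₁∈S ,
      ascent-monitors (≡.trans cut₁≡p (cong (_+ p) (≡.sym cut₀≡0))) (≡.trans (≡.sym (+-assoc p q s)) p+q+s≡n)
        p<q+s (≤-trans (≤-reflexive cut₀≡0) z≤n) (≤-trans k<p (≤-reflexive (≡.sym cut₁≡p))) kl
    ... | no k≮p | yes k<p+q =
      cut₁ , cut₂ , cut₁∈S , cut₂∈S ,
      ascent-monitors (≡.trans cut₂≡p+q (cong (_+ q) (≡.sym cut₁≡p)))
        (≡.trans (≡.sym (+-assoc q p s)) (≡.trans (cong (_+ s) (+-comm q p)) p+q+s≡n))
        q<p+s (≤-trans (≤-reflexive cut₁≡p) (≮⇒≥ k≮p)) (≤-trans k<p+q (≤-reflexive (≡.sym cut₂≡p+q))) kl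
    ... | no _ | no k≮p+q =
      cut₂ , cut₀ , cut₂∈S , cut₀∈S ,
      wrapArc-monitors cut₀≡0 (≡.trans (cong (_+ s) cut₂≡p+q) p+q+s≡n)
        (≤-trans s<p+q (≤-reflexive (≡.sym cut₂≡p+q))) (≤-trans (≤-reflexive cut₂≡p+q) (≮⇒≥ k≮p+q)) kl

    isMEG : IsMEGSet C S
    isMEG u v adj with adj⇒cycleStep adj
    ... | inj₁ uv = monitored uv
    ... | inj₂ vu = let x , y , x∈S , y∈S , mon = monitored vu in x , y , x∈S , y∈S , monitors-flip mon

  cycle-3≤∣MEGSet∣ : {S : Subset n} → IsMEGSet C S → 3 ≤ ∣ S ∣
  cycle-3≤∣MEGSet∣ = 3≤∣MEGSet∣ (cycleStep⇒adj (proj₂ (successor v))) missesAnEdge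
    where
    v : Fin n
    v = fromℕ< (≤-trans (s≤s z≤n) 3≤n)

  cycle-MEG≡3 : ArcSplit n → MEG≡ C 3
  cycle-MEG≡3 split =
    let S , isMEG , ∣S∣≤3 = arcSplit-MEGSet split
    in (S , isMEG , ≤-antisym ∣S∣≤3 (cycle-3≤∣MEGSet∣ isMEG)) , λ _ → cycle-3≤∣MEGSet∣

3≤4 : 3 ≤ 4
3≤4 = s≤s (s≤s (s≤s z≤n))

C₄ : Graph 4
C₄ = Cycle 4 3≤4

private
  variable
    v l x y : Fin 4

C₄-ordered-¬monitors : toℕ x < toℕ y → x ≢ v → y ≢ v → CycleStep v l → ¬ Monitors C₄ x y v l
C₄-ordered-¬monitors {x = x} {y = y} {v = v} x<y x≢v y≢v vl with arcLengths (<⇒≤ x<y)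
... | d , e , y≡x+d , d+e≡4 with <-cmp (toℕ v) (toℕ x) | <-cmp (toℕ v) (toℕ y)
... | tri≈ _ v≡x _ | _             = contradiction (toℕ-injective (≡.sym v≡x)) x≢v
... | _            | tri≈ _ v≡y _  = contradiction (toℕ-injective (≡.sym v≡y)) y≢v
... | tri< v<x _ _ | _             =
  ascent-¬monitors 3≤4 y≡x+d d+e≡4 (2d≤d+e⇒d≤e d+e≡4 (+-mono-≤ d≤2 d≤2)) vl (λ (x≤v , _) → <⇒≱ v<x x≤v)
  where
  1≤x : 1 ≤ toℕ x
  1≤x = ≤-trans (s≤s z≤n) v<x
  x+d≤3 : toℕ x + d ≤ 3
  x+d≤3 = ≤-trans (≤-reflexive (≡.sym y≡x+d)) (≤-pred (toℕ<n y))
  d≤2 : d ≤ 2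
  d≤2 = ≤-pred (≤-trans (+-monoˡ-≤ d 1≤x) x+d≤3)
... | tri> _ _ x<v | tri> _ _ y<v =
  ascent-¬monitors 3≤4 y≡x+d d+e≡4 (2d≤d+e⇒d≤e d+e≡4 (+-mono-≤ d≤2 d≤2)) vl
    (λ (_ , v<y) → <-asym v<y y<v)
  where
  d≤2 : d ≤ 2
  d≤2 = ≤-trans (m≤n+m d (toℕ x)) (≤-trans (≤-reflexive (≡.sym y≡x+d)) (≤-pred (≤-trans y<v (≤-pred (toℕ<n v)))))
... | tri> _ _ x<v | tri< v<y _ _ =
  wrapArc-¬monitors 3≤4 y≡x+d d+e≡4 (d+e≤2d⇒e≤d d+e≡4 (+-mono-≤ 2≤d 2≤d)) vl [ <⇒≱ v<y , <-asym x<v ]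
    ∘ monitors-sym
  where
  2≤d : 2 ≤ d
  2≤d = +-cancelʳ-≤ (toℕ x) 2 d (≤-trans (≤-trans (s≤s x<v) v<y) (≤-reflexive (≡.trans y≡x+d (+-comm (toℕ x) d))))

C₄-edge-monitors : CycleStep v l → Monitors C₄ x y v l → x ≡ v ⊎ y ≡ v
C₄-edge-monitors {v = v} {l = l} {x = x} {y = y} vl mon with x ≟ᶠ v | y ≟ᶠ v
... | yes x≡v | _       = inj₁ x≡v
... | no _    | yes y≡v = inj₂ y≡v
... | no x≢v  | no y≢v with <-cmp (toℕ x) (toℕ y)
...   | tri< x<y _ _ = ⊥-elim (C₄-ordered-¬monitors x<y x≢v y≢v vl mon)
...   | tri≈ _ x≡y _ = ⊥-elim (¬monitors-refl (≡.subst (λ z → Monitors C₄ z y v l) (toℕ-injective x≡y) mon))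
...   | tri> _ _ y<x = ⊥-elim (C₄-ordered-¬monitors y<x y≢v x≢v vl (monitors-sym mon))

C₄-MEG≡4 : MEG≡ C₄ 4
C₄-MEG≡4 = (⊤ , ⊤-isMEGSet , ∣⊤∣≡n 4) , λ _ → n≤∣MEGSet∣ privateEdge
  where
  privateEdge : ∀ v → ∃[ l ] (CycleAdj 4 v l × ∀ {x y} → Monitors C₄ x y v l → x ≡ v ⊎ y ≡ v)
  privateEdge v = let l , vl = successor v in l , cycleStep⇒adj vl , C₄-edge-monitors vl

theorem2 : ((n : ℕ) (h : 3 ≤ n) → (n ≡ 3 ⊎ 5 ≤ n) → MEG≡ (Cycle n h) 3)
           × MEG≡ (Cycle 4 (s≤s (s≤s (s≤s z≤n)))) 4
theorem2 = (λ n h n≡3⊎5≤n → cycle-MEG≡3 h (arcSplit n≡3⊎5≤n)) , C₄-MEG≡4
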